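{- Let $m>1$ be odd and let $f:\mathbb{Z}_m\to\{\pm1,\pm\mathrm{i}\}$ be a quaternary sequence. Let $\phi:\mathbb{Z}_2\times\mathbb{Z}_m\to\{\pm1\}$ be given by $\phi(0,k)=\mathrm{Re}(f(k))-\mathrm{Im}(f(k))$, $\phi(1,k)=\mathrm{Re}(f(k))+\mathrm{Im}(f(k))$, and let $\varphi:\mathbb{Z}_{2m}\to\{\pm1\}$ be the unique binary sequence such that, for $a\in\{0,1\}$ and $k\in\{0,\dots,m-1\}$ (indices of $\varphi$ modulo $2m$): if $m\equiv1\bmod4$, $\phi(a,k)$ equals $\varphi(k+am)$, $(-1)^{1-a}\varphi(k+(1-a)m)$, $-\varphi(k+am)$, $(-1)^a\varphi(k+(1-a)m)$ according as $k\equiv0,1,2,3\bmod4$; if $m\equiv3\bmod4$, $\phi(a,k)$ equals $(-1)^a\varphi(k+am)$, $\varphi(k+(1-a)m)$, $(-1)^{1-a}\varphi(k+am)$, $-\varphi(k+(1-a)m)$ according as $k\equiv0,1,2,3\bmod4$. Then $f$ is an OQS if and only if $\varphi$ is a GOBS of length $2m$.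
   Context: $\mathrm{i}=\sqrt{ -1}$. For $\theta:A\to\mathbb{C}$ on a finite abelian group $A$, $R_\theta(x)=\sum_{b\in A}\theta(b)\overline{\theta(x+b)}$. A quaternary sequence $f$ of odd length $m$ is an OQS if $|R_f(w)|=1$ for $1\le w\le m-1$. For a binary sequence $\varphi$ of length $2m$, its expansion is $\varphi':\mathbb{Z}_{4m}\to\{\pm1\}$ with $\varphi'(x)=\varphi(x)$ for $0\le x<2m$ and $\varphi'(x)=-\varphi(x-2m)$ for $2m\le x<4m$; $\varphi$ is a GOBS if $R_{\varphi'}(x)\in\{0,\pm4\}$ for all $x\in\mathbb{Z}_{4m}\setminus\{0,2m\}$ and the number of $x\in\mathbb{Z}_{4m}$ with $R_{\varphi'}(x)=0$ is $2m$. -}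

module Defs where

open import Data.Nat as ℕ using (ℕ; zero; suc; NonZero; _%_; _<_; _≤_)
open import Relation.Nullary
open import Data.Nat.DivMod using (_mod_)
open import Data.Nat.Properties using (m*n≢0)
open import Data.Fin using (Fin; toℕ)
open import Data.Integer as ℤ using (ℤ; +_; -_; _-_; -[1+_])
open import Data.Bool using (Bool; if_then_else_)
open import Relation.Nullary.Decidable using (⌊_⌋)
open import Data.Product using (_×_; _,_)
open import Data.Sum using (_⊎_)
open import Relation.Binary.PropositionalEquality using (_≡_; _≢_)

record ℤ[i] : Set where
  constructor _+i_
  field
    re : ℤ
    im : ℤ
open ℤ[i] public
infix 5 _+i_

0ᶜ : ℤ[i]
0ᶜ = + 0 +i + 0

_+ᶜ_ : ℤ[i] → ℤ[i] → ℤ[i]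
(a +i b) +ᶜ (c +i d) = (a ℤ.+ c) +i (b ℤ.+ d)

_*ᶜ_ : ℤ[i] → ℤ[i] → ℤ[i]
(a +i b) *ᶜ (c +i d) = (a ℤ.* c - b ℤ.* d) +i (a ℤ.* d ℤ.+ b ℤ.* c)

conj : ℤ[i] → ℤ[i]
conj (a +i b) = a +i (- b)

normSq : ℤ[i] → ℤ
normSq (a +i b) = a ℤ.* a ℤ.+ b ℤ.* b

∑ᶜ : (n : ℕ) → (Fin n → ℤ[i]) → ℤ[i]
∑ᶜ zero    g = 0ᶜ
∑ᶜ (suc n) g = g Data.Fin.zero +ᶜ ∑ᶜ n (λ j → g (Data.Fin.suc j))

∑ : (n : ℕ) → (Fin n → ℤ) → ℤ
∑ zero    g = + 0
∑ (suc n) g = g Data.Fin.zero ℤ.+ ∑ n (λ j → g (Data.Fin.suc j))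

count : (n : ℕ) → (Fin n → Bool) → ℕ
count zero    P = 0
count (suc n) P = (if P Data.Fin.zero then 1 else 0) ℕ.+ count n (λ j → P (Data.Fin.suc j))

shift : (n : ℕ) .{{_ : NonZero n}} → Fin n → ℕ → Fin n
shift n b w = (toℕ b ℕ.+ w) mod n

Rᶜ : (n : ℕ) .{{_ : NonZero n}} → (Fin n → ℤ[i]) → ℕ → ℤ[i]
Rᶜ n θ x = ∑ᶜ n (λ b → θ b *ᶜ conj (θ (shift n b x)))

R : (n : ℕ) .{{_ : NonZero n}} → (Fin n → ℤ) → ℕ → ℤ
R n θ x = ∑ n (λ b → θ b ℤ.* θ (shift n b x))

data Quat : Set where
  q1 qi qm1 qmi : Quat

toℂ : Quat → ℤ[i]
toℂ q1  = + 1 +i + 0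
toℂ qi  = + 0 +i + 1
toℂ qm1 = -[1+ 0 ] +i + 0
toℂ qmi = + 0 +i -[1+ 0 ]

data Bin : Set where
  b1 bm1 : Bin

val : Bin → ℤ
val b1  = + 1
val bm1 = -[1+ 0 ]

IsOQS : (m : ℕ) .{{_ : NonZero m}} → (Fin m → Quat) → Set
IsOQS m f = (w : ℕ) → 1 ≤ w → w < m → normSq (Rᶜ m (λ k → toℂ (f k)) w) ≡ + 1

expansion : (m : ℕ) .{{_ : NonZero m}} → (Fin (2 ℕ.* m) → Bin) → Fin (4 ℕ.* m) → ℤ
expansion m φ x with toℕ x ℕ.<? 2 ℕ.* m
... | Relation.Nullary.yes _ = val (φ ((toℕ x mod (2 ℕ.* m)) {{m*n≢0 2 m}}))
... | Relation.Nullary.no  _ = - val (φ (((toℕ x ℕ.∸ 2 ℕ.* m) mod (2 ℕ.* m)) {{m*n≢0 2 m}}))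

IsGOBS : (m : ℕ) .{{_ : NonZero m}} → (Fin (2 ℕ.* m) → Bin) → Set
IsGOBS m φ =
  ((x : Fin (4 ℕ.* m)) → toℕ x ≢ 0 → toℕ x ≢ 2 ℕ.* m →
      (Rφ' (toℕ x) ≡ + 0) ⊎ ((Rφ' (toℕ x) ≡ + 4) ⊎ (Rφ' (toℕ x) ≡ - + 4)))
  × count (4 ℕ.* m) (λ x → ⌊ Rφ' (toℕ x) ℤ.≟ + 0 ⌋) ≡ 2 ℕ.* m
  where
    Rφ' : ℕ → ℤ
    Rφ' = R (4 ℕ.* m) {{m*n≢0 4 m}} (expansion m φ)

ϕ : ∀ {m} → (Fin m → Quat) → ℕ → Fin m → ℤ
ϕ f zero    k = re (toℂ (f k)) - im (toℂ (f k))
ϕ f (suc _) k = re (toℂ (f k)) ℤ.+ im (toℂ (f k))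

sgn : ℕ → ℤ
sgn e = -[1+ 0 ] ℤ.^ e

φat : (m : ℕ) .{{_ : NonZero m}} → (Fin (2 ℕ.* m) → Bin) → ℕ → ℤ
φat m φ j = val (φ ((j mod (2 ℕ.* m)) {{m*n≢0 2 m}}))

Related : (m : ℕ) .{{_ : NonZero m}} → (Fin m → Quat) → (Fin (2 ℕ.* m) → Bin) → Set
Related m f φ = (a : Fin 2) (k : Fin m) → ϕ f (toℕ a) k ≡ rhs (toℕ a) (toℕ k)
  where
    A B : ℕ → ℕ → ℤ
    A a k = φat m φ (k ℕ.+ a ℕ.* m)
    B a k = φat m φ (k ℕ.+ (1 ℕ.∸ a) ℕ.* m)
    rhs : ℕ → ℕ → ℤ
    rhs a k with m % 4 | k % 4
    ... | 1 | 0 = A a k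
    ... | 1 | 1 = sgn (1 ℕ.∸ a) ℤ.* B a k
    ... | 1 | 2 = - A a k
    ... | 1 | _ = sgn a ℤ.* B a k
    ... | _ | 0 = sgn a ℤ.* A a k
    ... | _ | 1 = B a k
    ... | _ | 2 = sgn (1 ℕ.∸ a) ℤ.* A a k
    ... | _ | _ = - B a k

module Submission where

open import Defs
open import Data.Nat using (ℕ; NonZero; _<_; _%_)
open import Data.Product using (_×_)
open import Data.Fin using (Fin)
open import Relation.Binary.PropositionalEquality using (_≡_)

open import Algebra.Bundles using (CommutativeMonoid)
open import Data.Bool using (if_then_else_)
open import Data.Empty using (⊥-elim)
open import Data.Fin as Fin using (toℕ; fromℕ<)
open import Data.Fin.Patterns using (0F; 1F)
open import Data.Fin.Properties using (toℕ<n; toℕ-fromℕ<; toℕ-injective)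
open import Data.Integer as ℤ using (ℤ; +_; -_; _+_; _-_; _*_; -[1+_])
import Data.Integer.Properties as ℤP
open import Data.Integer.Tactic.RingSolver using (solve-∀)
open import Data.Nat as ℕ using (zero; suc; s≤s; z≤n; _/_; _<?_)
open import Data.Nat.Divisibility using (divides)
open import Data.Nat.DivMod
  using ( _mod_; %-distribˡ-+; [m+n]%n≡m%n; %-distribˡ-*; m%n%n≡m%n; m%n<n; [m+kn]%n≡m%n; m<n⇒m%n≡m
        ; m≡m%n+[m/n]*n; m<n*o⇒m/o<n; m∣n⇒o%n%m≡o%m; m*n%n≡0 )
import Data.Nat.Properties as ℕP
open import Data.Nat.Properties using (m*n≢0)
open import Data.Product using (_,_; proj₁; proj₂; ∃-syntax)
open import Data.Sum using (_⊎_; inj₁; inj₂)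
open import Function using (_∘_)
open import Relation.Binary.PropositionalEquality
  using (_≢_; refl; sym; trans; cong; cong₂; subst; module ≡-Reasoning)
open import Relation.Nullary using (¬_; yes; no)
open import Relation.Nullary.Decidable using (⌊_⌋)

-- Extend f periodically to ℕ and let ψ(n) = ϕ₄(n mod 4, f(n mod m)), where
-- ϕ₄(c, z) = Re(i⁻ᶜ(1 + i)z); the defining relation says precisely that the expansion
-- φ' of φ is ψ on ℤ_{4m}. As m is odd, n ↦ (n mod 4, n mod m) is a bijection
-- ℤ_{4m} ≅ ℤ₄ × ℤ_m, and summing the products ϕ₄(c, z)ϕ₄(c + d, w) over c ∈ ℤ₄ gives
-- 4 Re(iᵈ z w̄). Hence R_{φ'}(x) = 4 Re(iˣ R_f(x)). If every R_f(w), 0 < w < m, is a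
-- unit, these values lie in {0, ±4}, and exactly two of the four rotations of each
-- R_f(w) (and of R_f(0) = m) have real part 0, giving 2m zeros. Conversely, x = w and
-- x = w + m have opposite parities, so the GOBS condition gives Re R_f(w), Im R_f(w)
-- ∈ {0, ±1}; since R_f(w) is a sum of m units, Re + Im is odd, so R_f(w) is a unit.

[m+n%d]%d≡[m+n]%d : ∀ m n d .{{_ : NonZero d}} → (m ℕ.+ n % d) % d ≡ (m ℕ.+ n) % d
[m+n%d]%d≡[m+n]%d m n d = begin
  (m ℕ.+ n % d) % d          ≡⟨ %-distribˡ-+ m (n % d) d ⟩
  (m % d ℕ.+ n % d % d) % d  ≡⟨ cong (λ t → (m % d ℕ.+ t) % d) (m%n%n≡m%n n d) ⟩
  (m % d ℕ.+ n % d) % d      ≡⟨ %-distribˡ-+ m n d ⟨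
  (m ℕ.+ n) % d              ∎
  where open ≡-Reasoning

[m*[n%d]]%d≡[m*n]%d : ∀ m n d .{{_ : NonZero d}} → (m ℕ.* (n % d)) % d ≡ (m ℕ.* n) % d
[m*[n%d]]%d≡[m*n]%d m n d = begin
  (m ℕ.* (n % d)) % d          ≡⟨ %-distribˡ-* m (n % d) d ⟩
  (m % d ℕ.* (n % d % d)) % d  ≡⟨ cong (λ t → (m % d ℕ.* t) % d) (m%n%n≡m%n n d) ⟩
  (m % d ℕ.* (n % d)) % d      ≡⟨ %-distribˡ-* m n d ⟨
  (m ℕ.* n) % d                ∎
  where open ≡-Reasoning

[m*n+o]%d≡[m*[n%d]+o%d]%d : ∀ m n o d .{{_ : NonZero d}} →
                            (m ℕ.* n ℕ.+ o) % d ≡ (m ℕ.* (n % d) ℕ.+ o % d) % d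
[m*n+o]%d≡[m*[n%d]+o%d]%d m n o d = begin
  (m ℕ.* n ℕ.+ o) % d                  ≡⟨ %-distribˡ-+ (m ℕ.* n) o d ⟩
  ((m ℕ.* n) % d ℕ.+ o % d) % d        ≡⟨ cong (λ t → (t ℕ.+ o % d) % d) ([m*[n%d]]%d≡[m*n]%d m n d) ⟨
  ((m ℕ.* (n % d)) % d ℕ.+ o % d) % d  ≡⟨ %-distribˡ-+ (m ℕ.* (n % d)) o d ⟨
  (m ℕ.* (n % d) ℕ.+ o) % d            ≡⟨ [m+n%d]%d≡[m+n]%d (m ℕ.* (n % d)) o d ⟨
  (m ℕ.* (n % d) ℕ.+ o % d) % d        ∎
  where open ≡-Reasoning

[m%d+n]%d≡[m+n]%d : ∀ m n d .{{_ : NonZero d}} → (m % d ℕ.+ n) % d ≡ (m ℕ.+ n) % d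
[m%d+n]%d≡[m+n]%d m n d = begin
  (m % d ℕ.+ n) % d  ≡⟨ cong (_% d) (ℕP.+-comm (m % d) n) ⟩
  (n ℕ.+ m % d) % d  ≡⟨ [m+n%d]%d≡[m+n]%d n m d ⟩
  (n ℕ.+ m) % d      ≡⟨ cong (_% d) (ℕP.+-comm n m) ⟩
  (m ℕ.+ n) % d      ∎
  where open ≡-Reasoning

n%4%2≡n%2 : ∀ n → n % 4 % 2 ≡ n % 2
n%4%2≡n%2 n = m∣n⇒o%n%m≡o%m 2 4 n (divides 2 refl)

odd⇒%4≡1⊎3 : ∀ m → m % 2 ≡ 1 → m % 4 ≡ 1 ⊎ m % 4 ≡ 3
odd⇒%4≡1⊎3 m odd with m % 4 | m%n<n m 4 | n%4%2≡n%2 m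
... | 1 | _ | _  = inj₁ refl
... | 3 | _ | _  = inj₂ refl
... | 0 | _ | eq = ⊥-elim (ℕP.0≢1+n (trans eq odd))
... | 2 | _ | eq = ⊥-elim (ℕP.0≢1+n (trans eq odd))
... | suc (suc (suc (suc _))) | s≤s (s≤s (s≤s (s≤s ()))) | _

module FinSum {c ℓ} (M : CommutativeMonoid c ℓ) where

  open CommutativeMonoid M
    renaming (refl to ≈-refl; sym to ≈-sym; trans to ≈-trans)
  open import Algebra.Properties.CommutativeMonoid.Sum M public
    using (sum; sum-syntax; sum-cong-≋; sum-cong-≗; ∑-comm)
  open import Algebra.Solver.CommutativeMonoid M using (solve; _⊜_; _⊕_; id)
  open import Relation.Binary.Reasoning.Setoid setoid

  ∑-+ : ∀ a b (g : ℕ → Carrier) →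
        ∑[ i < a ℕ.+ b ] g (toℕ i) ≈ ∑[ i < a ] g (toℕ i) ∙ ∑[ i < b ] g (a ℕ.+ toℕ i)
  ∑-+ zero    b g = ≈-sym (identityˡ _)
  ∑-+ (suc a) b g = ≈-trans (∙-congˡ (∑-+ a b (g ∘ suc))) (≈-sym (assoc _ _ _))

  ∑-* : ∀ q m (g : ℕ → Carrier) →
        ∑[ i < q ℕ.* m ] g (toℕ i) ≈ ∑[ j < q ] ∑[ k < m ] g (toℕ j ℕ.* m ℕ.+ toℕ k)
  ∑-* zero    m g = ≈-refl
  ∑-* (suc q) m g = begin
    ∑[ i < m ℕ.+ q ℕ.* m ] g (toℕ i)
      ≈⟨ ∑-+ m (q ℕ.* m) g ⟩
    ∑[ k < m ] g (toℕ k) ∙ ∑[ i < q ℕ.* m ] g (m ℕ.+ toℕ i)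
      ≈⟨ ∙-congˡ (∑-* q m (λ i → g (m ℕ.+ i))) ⟩
    ∑[ k < m ] g (toℕ k) ∙ ∑[ j < q ] ∑[ k < m ] g (m ℕ.+ (toℕ j ℕ.* m ℕ.+ toℕ k))
      ≈⟨ ∙-congˡ (sum-cong-≋ {q} λ j → sum-cong-≋ {m} λ k →
           reflexive (cong g (sym (ℕP.+-assoc m (toℕ j ℕ.* m) (toℕ k))))) ⟩
    ∑[ j < suc q ] ∑[ k < m ] g (toℕ j ℕ.* m ℕ.+ toℕ k) ∎

  ∑-orbit-mod-4 : ∀ e c → e ≡ 1 ⊎ e ≡ 3 → c < 4 → (V : ℕ → Carrier) →
                  ∑[ j < 4 ] V ((toℕ j ℕ.* e ℕ.+ c) % 4) ≈ ∑[ d < 4 ] V (toℕ d)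
  ∑-orbit-mod-4 .1 0 (inj₁ refl) _ V = ≈-refl
  ∑-orbit-mod-4 .1 1 (inj₁ refl) _ V =
    solve 4 (λ a b c d → b ⊕ (c ⊕ (d ⊕ (a ⊕ id))) ⊜ a ⊕ (b ⊕ (c ⊕ (d ⊕ id)))) ≈-refl (V 0) (V 1) (V 2) (V 3)
  ∑-orbit-mod-4 .1 2 (inj₁ refl) _ V =
    solve 4 (λ a b c d → c ⊕ (d ⊕ (a ⊕ (b ⊕ id))) ⊜ a ⊕ (b ⊕ (c ⊕ (d ⊕ id)))) ≈-refl (V 0) (V 1) (V 2) (V 3)
  ∑-orbit-mod-4 .1 3 (inj₁ refl) _ V =
    solve 4 (λ a b c d → d ⊕ (a ⊕ (b ⊕ (c ⊕ id))) ⊜ a ⊕ (b ⊕ (c ⊕ (d ⊕ id)))) ≈-refl (V 0) (V 1) (V 2) (V 3)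
  ∑-orbit-mod-4 .3 0 (inj₂ refl) _ V =
    solve 4 (λ a b c d → a ⊕ (d ⊕ (c ⊕ (b ⊕ id))) ⊜ a ⊕ (b ⊕ (c ⊕ (d ⊕ id)))) ≈-refl (V 0) (V 1) (V 2) (V 3)
  ∑-orbit-mod-4 .3 1 (inj₂ refl) _ V =
    solve 4 (λ a b c d → b ⊕ (a ⊕ (d ⊕ (c ⊕ id))) ⊜ a ⊕ (b ⊕ (c ⊕ (d ⊕ id)))) ≈-refl (V 0) (V 1) (V 2) (V 3)
  ∑-orbit-mod-4 .3 2 (inj₂ refl) _ V =
    solve 4 (λ a b c d → c ⊕ (b ⊕ (a ⊕ (d ⊕ id))) ⊜ a ⊕ (b ⊕ (c ⊕ (d ⊕ id)))) ≈-refl (V 0) (V 1) (V 2) (V 3)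
  ∑-orbit-mod-4 .3 3 (inj₂ refl) _ V =
    solve 4 (λ a b c d → d ⊕ (c ⊕ (b ⊕ (a ⊕ id))) ⊜ a ⊕ (b ⊕ (c ⊕ (d ⊕ id)))) ≈-refl (V 0) (V 1) (V 2) (V 3)
  ∑-orbit-mod-4 _ (suc (suc (suc (suc _)))) _ (s≤s (s≤s (s≤s (s≤s ())))) V

  ∑-residues : ∀ m .{{_ : NonZero m}} → m % 2 ≡ 1 → (H : ℕ → ℕ → Carrier) →
               ∑[ n < 4 ℕ.* m ] H (toℕ n % 4) (toℕ n % m) ≈ ∑[ k < m ] ∑[ c < 4 ] H (toℕ c) (toℕ k)
  ∑-residues m odd H = begin
    ∑[ n < 4 ℕ.* m ] H (toℕ n % 4) (toℕ n % m)
      ≈⟨ ∑-* 4 m (λ n → H (n % 4) (n % m)) ⟩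
    ∑[ j < 4 ] ∑[ k < m ] H ((toℕ j ℕ.* m ℕ.+ toℕ k) % 4) ((toℕ j ℕ.* m ℕ.+ toℕ k) % m)
      ≈⟨ ∑-comm {4} {m} (λ j k → H ((toℕ j ℕ.* m ℕ.+ toℕ k) % 4) ((toℕ j ℕ.* m ℕ.+ toℕ k) % m)) ⟩
    ∑[ k < m ] ∑[ j < 4 ] H ((toℕ j ℕ.* m ℕ.+ toℕ k) % 4) ((toℕ j ℕ.* m ℕ.+ toℕ k) % m)
      ≈⟨ sum-cong-≋ {m} (λ k → sum-cong-≋ {4} λ j → reflexive (cong₂ H
           ([m*n+o]%d≡[m*[n%d]+o%d]%d (toℕ j) m (toℕ k) 4) (j*m+k%m≡k (toℕ j) k))) ⟩
    ∑[ k < m ] ∑[ j < 4 ] H ((toℕ j ℕ.* (m % 4) ℕ.+ toℕ k % 4) % 4) (toℕ k)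
      ≈⟨ sum-cong-≋ {m} (λ k → ∑-orbit-mod-4 (m % 4) (toℕ k % 4) (odd⇒%4≡1⊎3 m odd)
           (m%n<n (toℕ k) 4) (λ c → H c (toℕ k))) ⟩
    ∑[ k < m ] ∑[ c < 4 ] H (toℕ c) (toℕ k) ∎
    where
    j*m+k%m≡k : ∀ j (k : Fin m) → (j ℕ.* m ℕ.+ toℕ k) % m ≡ toℕ k
    j*m+k%m≡k j k = trans (cong (_% m) (ℕP.+-comm (j ℕ.* m) (toℕ k)))
                      (trans ([m+kn]%n≡m%n (toℕ k) j m) (m<n⇒m%n≡m (toℕ<n k)))

module ℤSum = FinSum ℤP.+-0-commutativeMonoid
module ℕSum = FinSum ℕP.+-0-commutativeMonoid

∑≡sum : ∀ n (g : Fin n → ℤ) → ∑ n g ≡ ℤSum.sum g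
∑≡sum zero    g = refl
∑≡sum (suc n) g = cong (_+_ (g 0F)) (∑≡sum n (g ∘ Fin.suc))

isZero : ℤ → ℕ
isZero v = if ⌊ v ℤ.≟ + 0 ⌋ then 1 else 0

count≡sum : ∀ n (g : Fin n → ℤ) → count n (λ i → ⌊ g i ℤ.≟ + 0 ⌋) ≡ ℕSum.sum (isZero ∘ g)
count≡sum zero    g = refl
count≡sum (suc n) g = cong (ℕ._+_ (isZero (g 0F))) (count≡sum n (g ∘ Fin.suc))

sum-const : ∀ n c → ℕSum.sum {n} (λ _ → c) ≡ n ℕ.* c
sum-const zero    c = refl
sum-const (suc n) c = cong (c ℕ.+_) (sum-const n c)

-- ϕ₄ c z = Re(i⁻ᶜ(1 + i)z) for c < 4, so that ϕ₄ 0 and ϕ₄ 1 are the paper's ϕ(0, ·) and ϕ(1, ·)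
ϕ₄ : ℕ → ℤ[i] → ℤ
ϕ₄ 0 z = re z - im z
ϕ₄ 1 z = re z + im z
ϕ₄ 2 z = - (re z - im z)
ϕ₄ _ z = - (re z + im z)

-- reRot d z = 4 Re(iᵈ z) for d < 4
reRot : ℕ → ℤ[i] → ℤ
reRot 0 z = + 4 * re z
reRot 1 z = - (+ 4 * im z)
reRot 2 z = - (+ 4 * re z)
reRot _ z = + 4 * im z

ϕ₄-+2 : ∀ c → c < 4 → ∀ z → ϕ₄ ((c ℕ.+ 2) % 4) z ≡ - ϕ₄ c z
ϕ₄-+2 0 _ z = refl
ϕ₄-+2 1 _ z = refl
ϕ₄-+2 2 _ z = sym (ℤP.neg-involutive _)
ϕ₄-+2 3 _ z = sym (ℤP.neg-involutive _)
ϕ₄-+2 (suc (suc (suc (suc _)))) (s≤s (s≤s (s≤s (s≤s ())))) z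

-- Each identity below is the four-term sum written out, with z = a + b i and w = c + e i.
ϕ₄-correlation : ∀ d → d < 4 → ∀ z w →
                 ℤSum.sum (λ (c : Fin 4) → ϕ₄ (toℕ c) z * ϕ₄ ((toℕ c ℕ.+ d) % 4) w) ≡ reRot d (z *ᶜ conj w)
ϕ₄-correlation 0 _ (a +i b) (c +i e) = identity a b c e
  where
  identity : ∀ a b c e →
    (a - b) * (c - e) + ((a + b) * (c + e) + (- (a - b) * - (c - e) + (- (a + b) * - (c + e) + + 0)))
      ≡ + 4 * (a * c - b * - e)
  identity = solve-∀
ϕ₄-correlation 1 _ (a +i b) (c +i e) = identity a b c e
  where
  identity : ∀ a b c e →
    (a - b) * (c + e) + ((a + b) * - (c - e) + (- (a - b) * - (c + e) + (- (a + b) * (c - e) + + 0)))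
      ≡ - (+ 4 * (a * - e + b * c))
  identity = solve-∀
ϕ₄-correlation 2 _ (a +i b) (c +i e) = identity a b c e
  where
  identity : ∀ a b c e →
    (a - b) * - (c - e) + ((a + b) * - (c + e) + (- (a - b) * (c - e) + (- (a + b) * (c + e) + + 0)))
      ≡ - (+ 4 * (a * c - b * - e))
  identity = solve-∀
ϕ₄-correlation 3 _ (a +i b) (c +i e) = identity a b c e
  where
  identity : ∀ a b c e →
    (a - b) * - (c + e) + ((a + b) * (c - e) + (- (a - b) * (c + e) + (- (a + b) * - (c - e) + + 0)))
      ≡ + 4 * (a * - e + b * c)
  identity = solve-∀
ϕ₄-correlation (suc (suc (suc (suc _)))) (s≤s (s≤s (s≤s (s≤s ())))) z w

∑ᶜ-hom : (h : ℤ[i] → ℤ) → h 0ᶜ ≡ + 0 → (∀ v w → h (v +ᶜ w) ≡ h v + h w) →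
         ∀ n g → h (∑ᶜ n g) ≡ ∑ n (h ∘ g)
∑ᶜ-hom h h-0 h-+ zero    g = h-0
∑ᶜ-hom h h-0 h-+ (suc n) g =
  trans (h-+ _ _) (cong (_+_ (h (g 0F))) (∑ᶜ-hom h h-0 h-+ n (g ∘ Fin.suc)))

reRot-∑ᶜ : ∀ d n g → reRot d (∑ᶜ n g) ≡ ∑ n (reRot d ∘ g)
reRot-∑ᶜ d = ∑ᶜ-hom (reRot d) (reRot-0ᶜ d) (reRot-+ d)
  where
  reRot-0ᶜ : ∀ d → reRot d 0ᶜ ≡ + 0
  reRot-0ᶜ 0                   = refl
  reRot-0ᶜ 1                   = refl
  reRot-0ᶜ 2                   = refl
  reRot-0ᶜ (suc (suc (suc _))) = refl
  reRot-+ : ∀ d v w → reRot d (v +ᶜ w) ≡ reRot d v + reRot d w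
  reRot-+ 0 v w = ℤP.*-distribˡ-+ (+ 4) (re v) (re w)
  reRot-+ 1 v w =
    trans (cong -_ (ℤP.*-distribˡ-+ (+ 4) (im v) (im w))) (ℤP.neg-distrib-+ (+ 4 * im v) (+ 4 * im w))
  reRot-+ 2 v w =
    trans (cong -_ (ℤP.*-distribˡ-+ (+ 4) (re v) (re w))) (ℤP.neg-distrib-+ (+ 4 * re v) (+ 4 * re w))
  reRot-+ (suc (suc (suc _))) v w = ℤP.*-distribˡ-+ (+ 4) (im v) (im w)

re+im-∑ᶜ : ∀ n g → re (∑ᶜ n g) + im (∑ᶜ n g) ≡ ∑ n (λ j → re (g j) + im (g j))
re+im-∑ᶜ = ∑ᶜ-hom (λ z → re z + im z) refl (λ v w → interchange (re v) (re w) (im v) (im w))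
  where
  interchange : ∀ a b c d → (a + b) + (c + d) ≡ (a + c) + (b + d)
  interchange = solve-∀

normSq-*ᶜ-conj : ∀ z w → normSq (z *ᶜ conj w) ≡ normSq z * normSq w
normSq-*ᶜ-conj (a +i b) (c +i e) = identity a b c e
  where
  identity : ∀ a b c e →
    (a * c - b * - e) * (a * c - b * - e) + (a * - e + b * c) * (a * - e + b * c)
      ≡ (a * a + b * b) * (c * c + e * e)
  identity = solve-∀

data IsUnit : ℤ[i] → Set where
  u+1 : IsUnit (+ 1 +i + 0)
  u-1 : IsUnit (-[1+ 0 ] +i + 0)
  u+i : IsUnit (+ 0 +i + 1)
  u-i : IsUnit (+ 0 +i -[1+ 0 ])

normSq≡1⇒IsUnit : ∀ z → normSq z ≡ + 1 → IsUnit z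
normSq≡1⇒IsUnit (+ 0 +i + 0)                 ()
normSq≡1⇒IsUnit (+ 0 +i + 1)                 _  = u+i
normSq≡1⇒IsUnit (+ 0 +i + suc (suc _))       ()
normSq≡1⇒IsUnit (+ 0 +i -[1+ 0 ])            _  = u-i
normSq≡1⇒IsUnit (+ 0 +i -[1+ suc _ ])        ()
normSq≡1⇒IsUnit (+ 1 +i + 0)                 _  = u+1
normSq≡1⇒IsUnit (+ 1 +i + suc _)             ()
normSq≡1⇒IsUnit (+ 1 +i -[1+ _ ])            ()
normSq≡1⇒IsUnit (+ suc (suc _) +i + 0)       ()
normSq≡1⇒IsUnit (+ suc (suc _) +i + suc _)   ()
normSq≡1⇒IsUnit (+ suc (suc _) +i -[1+ _ ])  ()
normSq≡1⇒IsUnit (-[1+ 0 ] +i + 0)            _  = u-1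
normSq≡1⇒IsUnit (-[1+ 0 ] +i + suc _)        ()
normSq≡1⇒IsUnit (-[1+ 0 ] +i -[1+ _ ])       ()
normSq≡1⇒IsUnit (-[1+ suc _ ] +i + 0)        ()
normSq≡1⇒IsUnit (-[1+ suc _ ] +i + suc _)    ()
normSq≡1⇒IsUnit (-[1+ suc _ ] +i -[1+ _ ])   ()

IsUnit⇒normSq≡1 : ∀ {u} → IsUnit u → normSq u ≡ + 1
IsUnit⇒normSq≡1 u+1 = refl
IsUnit⇒normSq≡1 u-1 = refl
IsUnit⇒normSq≡1 u+i = refl
IsUnit⇒normSq≡1 u-i = refl

toℂ*conj-IsUnit : ∀ q q′ → IsUnit (toℂ q *ᶜ conj (toℂ q′))
toℂ*conj-IsUnit q q′ = normSq≡1⇒IsUnit _ (begin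
  normSq (toℂ q *ᶜ conj (toℂ q′))     ≡⟨ normSq-*ᶜ-conj (toℂ q) (toℂ q′) ⟩
  normSq (toℂ q) * normSq (toℂ q′)    ≡⟨ cong₂ _*_ (normSq-toℂ q) (normSq-toℂ q′) ⟩
  + 1                                 ∎)
  where
  open ≡-Reasoning
  normSq-toℂ : ∀ q → normSq (toℂ q) ≡ + 1
  normSq-toℂ q1  = refl
  normSq-toℂ qi  = refl
  normSq-toℂ qm1 = refl
  normSq-toℂ qmi = refl

toℂ*conj-self : ∀ q → toℂ q *ᶜ conj (toℂ q) ≡ + 1 +i + 0
toℂ*conj-self q1  = refl
toℂ*conj-self qi  = refl
toℂ*conj-self qm1 = refl
toℂ*conj-self qmi = refl

infix 4 _∈0±_

_∈0±_ : ℤ → ℕ → Set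
v ∈0± n = v ≡ + 0 ⊎ v ≡ + n ⊎ v ≡ - + n

IsUnit⇒parts : ∀ {u} → IsUnit u → re u ∈0± 1 × im u ∈0± 1
IsUnit⇒parts u+1 = inj₂ (inj₁ refl) , inj₁ refl
IsUnit⇒parts u-1 = inj₂ (inj₂ refl) , inj₁ refl
IsUnit⇒parts u+i = inj₁ refl , inj₂ (inj₁ refl)
IsUnit⇒parts u-i = inj₁ refl , inj₂ (inj₂ refl)

4*-∈0± : ∀ {v} → v ∈0± 1 → + 4 * v ∈0± 4
4*-∈0± (inj₁ refl)        = inj₁ refl
4*-∈0± (inj₂ (inj₁ refl)) = inj₂ (inj₁ refl)
4*-∈0± (inj₂ (inj₂ refl)) = inj₂ (inj₂ refl)

4*-∈0±⁻¹ : ∀ {v} → + 4 * v ∈0± 4 → v ∈0± 1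
4*-∈0±⁻¹ {v} (inj₁ eq)        = inj₁ (ℤP.*-cancelˡ-≡ (+ 4) v (+ 0) eq)
4*-∈0±⁻¹ {v} (inj₂ (inj₁ eq)) = inj₂ (inj₁ (ℤP.*-cancelˡ-≡ (+ 4) v (+ 1) eq))
4*-∈0±⁻¹ {v} (inj₂ (inj₂ eq)) = inj₂ (inj₂ (ℤP.*-cancelˡ-≡ (+ 4) v (- + 1) eq))

neg-∈0± : ∀ {v n} → v ∈0± n → - v ∈0± n
neg-∈0± (inj₁ refl)               = inj₁ refl
neg-∈0± (inj₂ (inj₁ refl))        = inj₂ (inj₂ refl)
neg-∈0± {n = n} (inj₂ (inj₂ refl)) = inj₂ (inj₁ (ℤP.neg-involutive (+ n)))

neg-∈0±⁻¹ : ∀ {v n} → - v ∈0± n → v ∈0± n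
neg-∈0±⁻¹ {v} {n} p = subst (_∈0± n) (ℤP.neg-involutive v) (neg-∈0± p)

reRot-∈0± : ∀ d z → re z ∈0± 1 → im z ∈0± 1 → reRot d z ∈0± 4
reRot-∈0± 0                   z r i = 4*-∈0± r
reRot-∈0± 1                   z r i = neg-∈0± (4*-∈0± i)
reRot-∈0± 2                   z r i = neg-∈0± (4*-∈0± r)
reRot-∈0± (suc (suc (suc _))) z r i = 4*-∈0± i

reRot-even⇒re∈0± : ∀ n z → n % 2 ≡ 0 → reRot (n % 4) z ∈0± 4 → re z ∈0± 1
reRot-even⇒re∈0± n z even p with n % 4 | m%n<n n 4 | n%4%2≡n%2 n
... | 0 | _ | _  = 4*-∈0±⁻¹ p
... | 2 | _ | _  = 4*-∈0±⁻¹ (neg-∈0±⁻¹ p)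
... | 1 | _ | eq = ⊥-elim (ℕP.1+n≢0 (trans eq even))
... | 3 | _ | eq = ⊥-elim (ℕP.1+n≢0 (trans eq even))
... | suc (suc (suc (suc _))) | s≤s (s≤s (s≤s (s≤s ()))) | _

reRot-odd⇒im∈0± : ∀ n z → n % 2 ≡ 1 → reRot (n % 4) z ∈0± 4 → im z ∈0± 1
reRot-odd⇒im∈0± n z odd p with n % 4 | m%n<n n 4 | n%4%2≡n%2 n
... | 1 | _ | _  = 4*-∈0±⁻¹ (neg-∈0±⁻¹ p)
... | 3 | _ | _  = 4*-∈0±⁻¹ p
... | 0 | _ | eq = ⊥-elim (ℕP.0≢1+n (trans eq odd))
... | 2 | _ | eq = ⊥-elim (ℕP.0≢1+n (trans eq odd))
... | suc (suc (suc (suc _))) | s≤s (s≤s (s≤s (s≤s ()))) | _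

reRot-odd-real : ∀ n r → n % 2 ≡ 1 → reRot (n % 4) (r +i + 0) ≡ + 0
reRot-odd-real n r odd with n % 4 | m%n<n n 4 | n%4%2≡n%2 n
... | 1 | _ | _  = refl
... | 3 | _ | _  = refl
... | 0 | _ | eq = ⊥-elim (ℕP.0≢1+n (trans eq odd))
... | 2 | _ | eq = ⊥-elim (ℕP.0≢1+n (trans eq odd))
... | suc (suc (suc (suc _))) | s≤s (s≤s (s≤s (s≤s ()))) | _

zeros : ℤ[i] → ℕ
zeros z = ℕSum.sum (λ (c : Fin 4) → isZero (reRot (toℕ c) z))

IsUnit⇒zeros≡2 : ∀ {u} → IsUnit u → zeros u ≡ 2
IsUnit⇒zeros≡2 u+1 = refl
IsUnit⇒zeros≡2 u-1 = refl
IsUnit⇒zeros≡2 u+i = refl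
IsUnit⇒zeros≡2 u-i = refl

zeros-positive : ∀ n .{{_ : NonZero n}} → zeros (+ n +i + 0) ≡ 2
zeros-positive (suc n) = refl

Odd : ℤ → Set
Odd v = ∃[ t ] v ≡ + 1 + + 2 * t

¬Odd[2*] : ∀ s → ¬ Odd (+ 2 * s)
¬Odd[2*] s (t , 2s≡1+2t) = ℕP.1+n≢0 (begin
  1                         ≡⟨ cong (_% 2) (trans (cong ℤ.∣_∣ 1≡2[s-t]) (ℤP.abs-* (+ 2) (s - t))) ⟩
  (2 ℕ.* ℤ.∣ s - t ∣) % 2   ≡⟨ cong (_% 2) (ℕP.*-comm 2 ℤ.∣ s - t ∣) ⟩
  (ℤ.∣ s - t ∣ ℕ.* 2) % 2   ≡⟨ m*n%n≡0 ℤ.∣ s - t ∣ 2 ⟩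
  0                         ∎)
  where
  open ≡-Reasoning
  cancel : ∀ t → + 1 ≡ (+ 1 + + 2 * t) - + 2 * t
  cancel = solve-∀
  factor : ∀ s t → + 2 * s - + 2 * t ≡ + 2 * (s - t)
  factor = solve-∀
  1≡2[s-t] : + 1 ≡ + 2 * (s - t)
  1≡2[s-t] = trans (cancel t) (trans (cong (_- + 2 * t) (sym 2s≡1+2t)) (factor s t))

∑-signs : ∀ n (g : Fin n → ℤ) → (∀ j → g j ≡ + 1 ⊎ g j ≡ - + 1) → ∃[ t ] ∑ n g ≡ + n + + 2 * t
∑-signs zero    g signs = + 0 , refl
∑-signs (suc n) g signs with g 0F | signs 0F | ∑-signs n (g ∘ Fin.suc) (signs ∘ Fin.suc)
... | _ | inj₁ refl | t , eq = t , trans (cong (_+_ (+ 1)) eq) (plus-one (+ n) t)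
  where
  plus-one : ∀ N t → + 1 + (N + + 2 * t) ≡ (+ 1 + N) + + 2 * t
  plus-one = solve-∀
... | _ | inj₂ refl | t , eq = t - + 1 , trans (cong (_+_ (- + 1)) eq) (minus-one (+ n) t)
  where
  minus-one : ∀ N t → - + 1 + (N + + 2 * t) ≡ (+ 1 + N) + + 2 * (t - + 1)
  minus-one = solve-∀

IsUnit⇒re+im≡±1 : ∀ {u} → IsUnit u → re u + im u ≡ + 1 ⊎ re u + im u ≡ - + 1
IsUnit⇒re+im≡±1 u+1 = inj₁ refl
IsUnit⇒re+im≡±1 u-1 = inj₂ refl
IsUnit⇒re+im≡±1 u+i = inj₁ refl
IsUnit⇒re+im≡±1 u-i = inj₂ refl

parts⇒IsUnit : ∀ z → re z ∈0± 1 → im z ∈0± 1 → Odd (re z + im z) → IsUnit z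
parts⇒IsUnit (_ +i _) (inj₁ refl)        (inj₁ refl)        odd = ⊥-elim (¬Odd[2*] (+ 0) odd)
parts⇒IsUnit (_ +i _) (inj₁ refl)        (inj₂ (inj₁ refl)) _   = u+i
parts⇒IsUnit (_ +i _) (inj₁ refl)        (inj₂ (inj₂ refl)) _   = u-i
parts⇒IsUnit (_ +i _) (inj₂ (inj₁ refl)) (inj₁ refl)        _   = u+1
parts⇒IsUnit (_ +i _) (inj₂ (inj₂ refl)) (inj₁ refl)        _   = u-1
parts⇒IsUnit (_ +i _) (inj₂ (inj₁ refl)) (inj₂ (inj₁ refl)) odd = ⊥-elim (¬Odd[2*] (+ 1) odd)
parts⇒IsUnit (_ +i _) (inj₂ (inj₁ refl)) (inj₂ (inj₂ refl)) odd = ⊥-elim (¬Odd[2*] (+ 0) odd)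
parts⇒IsUnit (_ +i _) (inj₂ (inj₂ refl)) (inj₂ (inj₁ refl)) odd = ⊥-elim (¬Odd[2*] (+ 0) odd)
parts⇒IsUnit (_ +i _) (inj₂ (inj₂ refl)) (inj₂ (inj₂ refl)) odd = ⊥-elim (¬Odd[2*] (- + 1) odd)

Odd-+2* : ∀ {v} → Odd v → ∀ t → Odd (v + + 2 * t)
Odd-+2* (s , refl) t = s + t , regroup s t
  where
  regroup : ∀ s t → + 1 + + 2 * s + + 2 * t ≡ + 1 + + 2 * (s + t)
  regroup = solve-∀

odd⇒Odd : ∀ n → n % 2 ≡ 1 → Odd (+ n)
odd⇒Odd n odd = + (n / 2) , (begin
  + n                        ≡⟨ cong +_ (m≡m%n+[m/n]*n n 2) ⟩
  + (n % 2 ℕ.+ n / 2 ℕ.* 2)  ≡⟨ cong (λ r → + (r ℕ.+ n / 2 ℕ.* 2)) odd ⟩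
  + 1 + + (n / 2 ℕ.* 2)      ≡⟨ cong (λ k → + 1 + + k) (ℕP.*-comm (n / 2) 2) ⟩
  + 1 + + (2 ℕ.* (n / 2))    ≡⟨ cong (_+_ (+ 1)) (ℤP.pos-* 2 (n / 2)) ⟩
  + 1 + + 2 * + (n / 2)      ∎)
  where open ≡-Reasoning

x≡1*y⇒y≡x : ∀ {x y} → x ≡ + 1 * y → y ≡ x
x≡1*y⇒y≡x {x} {y} eq = sym (trans eq (ℤP.*-identityˡ y))

x≡-1*y⇒y≡-x : ∀ {x y} → x ≡ -[1+ 0 ] * y → y ≡ - x
x≡-1*y⇒y≡-x {x} {y} eq = trans (sym (ℤP.neg-involutive y)) (cong -_ (sym (trans eq (ℤP.-1*i≡-i y))))

x≡-y⇒y≡-x : ∀ {x y} → x ≡ - y → y ≡ - x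
x≡-y⇒y≡-x {x} {y} eq = trans (sym (ℤP.neg-involutive y)) (cong -_ (sym eq))

∑ᶜ-cong : ∀ n {g h : Fin n → ℤ[i]} → (∀ j → g j ≡ h j) → ∑ᶜ n g ≡ ∑ᶜ n h
∑ᶜ-cong zero    eq = refl
∑ᶜ-cong (suc n) eq = cong₂ _+ᶜ_ (eq 0F) (∑ᶜ-cong n (eq ∘ Fin.suc))

∑ᶜ-one : ∀ n → ∑ᶜ n (λ _ → + 1 +i + 0) ≡ + n +i + 0
∑ᶜ-one zero    = refl
∑ᶜ-one (suc n) = cong ((+ 1 +i + 0) +ᶜ_) (∑ᶜ-one n)

module Correspondence (m : ℕ) .{{_ : NonZero m}} (m-odd : m % 2 ≡ 1) (f : Fin m → Quat) where

  open ≡-Reasoning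

  private instance
    2m≢0 : NonZero (2 ℕ.* m)
    2m≢0 = m*n≢0 2 m
    4m≢0 : NonZero (4 ℕ.* m)
    4m≢0 = m*n≢0 4 m

  f̃ : ℕ → ℤ[i]
  f̃ n = toℂ (f (n mod m))

  f̃-cong : ∀ {a b} → a % m ≡ b % m → f̃ a ≡ f̃ b
  f̃-cong eq = cong (toℂ ∘ f) (toℕ-injective (trans (toℕ-fromℕ< _) (trans eq (sym (toℕ-fromℕ< _)))))

  f̃-toℕ : ∀ k → f̃ (toℕ k) ≡ toℂ (f k)
  f̃-toℕ k = cong (toℂ ∘ f) (toℕ-injective (trans (toℕ-fromℕ< _) (m<n⇒m%n≡m (toℕ<n k))))

  ψ : ℕ → ℤ
  ψ n = ϕ₄ (n % 4) (f̃ n)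

  ψ-mod : ∀ n → ψ (n % (4 ℕ.* m)) ≡ ψ n
  ψ-mod n = cong₂ ϕ₄ (m∣n⇒o%n%m≡o%m 4 (4 ℕ.* m) n (divides m (ℕP.*-comm 4 m)))
                     (f̃-cong (m∣n⇒o%n%m≡o%m m (4 ℕ.* m) n (divides 4 refl)))

  ψ-antiperiodic : ∀ n → ψ (n ℕ.+ 2 ℕ.* m) ≡ - ψ n
  ψ-antiperiodic n = begin
    ϕ₄ ((n ℕ.+ 2 ℕ.* m) % 4) (f̃ (n ℕ.+ 2 ℕ.* m))  ≡⟨ cong₂ ϕ₄ residue (f̃-cong ([m+kn]%n≡m%n n 2 m)) ⟩
    ϕ₄ ((n % 4 ℕ.+ 2) % 4) (f̃ n)                  ≡⟨ ϕ₄-+2 (n % 4) (m%n<n n 4) (f̃ n) ⟩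
    - ψ n                                          ∎
    where
    2m%4≡2 : (2 ℕ.* m) % 4 ≡ 2
    2m%4≡2 with m % 4 | odd⇒%4≡1⊎3 m m-odd | [m*[n%d]]%d≡[m*n]%d 2 m 4
    ... | .1 | inj₁ refl | eq = sym eq
    ... | .3 | inj₂ refl | eq = sym eq
    residue : (n ℕ.+ 2 ℕ.* m) % 4 ≡ (n % 4 ℕ.+ 2) % 4
    residue = trans (%-distribˡ-+ n (2 ℕ.* m) 4) (cong (λ r → (n % 4 ℕ.+ r) % 4) 2m%4≡2)

  Rf : ℕ → ℤ[i]
  Rf = Rᶜ m (λ k → toℂ (f k))

  Rf-cong : ∀ {a b} → a % m ≡ b % m → Rf a ≡ Rf b
  Rf-cong {a} {b} eq = ∑ᶜ-cong m (λ k → cong (λ z → toℂ (f k) *ᶜ conj z) (f̃-cong (begin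
    (toℕ k ℕ.+ a) % m      ≡⟨ [m+n%d]%d≡[m+n]%d (toℕ k) a m ⟨
    (toℕ k ℕ.+ a % m) % m  ≡⟨ cong (λ r → (toℕ k ℕ.+ r) % m) eq ⟩
    (toℕ k ℕ.+ b % m) % m  ≡⟨ [m+n%d]%d≡[m+n]%d (toℕ k) b m ⟩
    (toℕ k ℕ.+ b) % m      ∎)))

  Rf-residue : ∀ n → Rf n ≡ Rf (n % m)
  Rf-residue n = Rf-cong (sym (m%n%n≡m%n n m))

  Rf-0 : Rf 0 ≡ + m +i + 0
  Rf-0 = trans (∑ᶜ-cong m λ k → trans (cong (λ z → toℂ (f k) *ᶜ conj z) (f̃-self k)) (toℂ*conj-self (f k)))
               (∑ᶜ-one m)
    where
    f̃-self : ∀ k → f̃ (toℕ k ℕ.+ 0) ≡ toℂ (f k)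
    f̃-self k = trans (cong f̃ (ℕP.+-identityʳ (toℕ k))) (f̃-toℕ k)

  Rf-Odd : ∀ x → Odd (re (Rf x) + im (Rf x))
  Rf-Odd x with ∑-signs m _ (λ j → IsUnit⇒re+im≡±1 (toℂ*conj-IsUnit (f j) (f (shift m j x))))
  ... | t , ∑≡ = subst Odd (sym (trans (re+im-∑ᶜ m _) ∑≡)) (Odd-+2* (odd⇒Odd m m-odd) t)

  open ℤSum using (sum-syntax)

  ψ-autocorrelation : ∀ x →
    ℤSum.sum (λ (b : Fin (4 ℕ.* m)) → ψ (toℕ b) * ψ (toℕ b ℕ.+ x)) ≡ reRot (x % 4) (Rf x)
  ψ-autocorrelation x = begin
    ∑[ b < 4 ℕ.* m ] (ψ (toℕ b) * ψ (toℕ b ℕ.+ x))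
      ≡⟨ sum-cong-≗ {4 ℕ.* m} (λ b → by-residues (toℕ b)) ⟩
    ∑[ b < 4 ℕ.* m ] H (toℕ b % 4) (toℕ b % m)
      ≡⟨ ∑-residues m m-odd H ⟩
    ∑[ k < m ] ∑[ c < 4 ] H (toℕ c) (toℕ k)
      ≡⟨ sum-cong-≗ {m} (λ k → ϕ₄-correlation d (m%n<n x 4) (f̃ (toℕ k)) (f̃ (toℕ k ℕ.+ x))) ⟩
    ∑[ k < m ] reRot d (f̃ (toℕ k) *ᶜ conj (f̃ (toℕ k ℕ.+ x)))
      ≡⟨ ∑≡sum m _ ⟨
    ∑ m (λ k → reRot d (f̃ (toℕ k) *ᶜ conj (f̃ (toℕ k ℕ.+ x))))
      ≡⟨ reRot-∑ᶜ d m _ ⟨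
    reRot d (∑ᶜ m (λ k → f̃ (toℕ k) *ᶜ conj (f̃ (toℕ k ℕ.+ x))))
      ≡⟨ cong (reRot d) (∑ᶜ-cong m λ k → cong (λ z → z *ᶜ conj (f̃ (toℕ k ℕ.+ x))) (f̃-toℕ k)) ⟩
    reRot d (Rf x) ∎
    where
    open ℤSum using (sum-cong-≗; ∑-residues)
    d = x % 4
    H : ℕ → ℕ → ℤ
    H c k = ϕ₄ c (f̃ k) * ϕ₄ ((c ℕ.+ d) % 4) (f̃ (k ℕ.+ x))
    by-residues : ∀ n → ψ n * ψ (n ℕ.+ x) ≡ H (n % 4) (n % m)
    by-residues n = cong₂ _*_ (cong (ϕ₄ (n % 4)) (f̃-cong (sym (m%n%n≡m%n n m))))
      (cong₂ ϕ₄ (%-distribˡ-+ n x 4) (f̃-cong (sym ([m%d+n]%d≡[m+n]%d n x m))))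

  oqs⇒Rf-IsUnit : IsOQS m f → ∀ w → suc w < m → IsUnit (Rf (suc w))
  oqs⇒Rf-IsUnit oqs w w<m = normSq≡1⇒IsUnit _ (oqs (suc w) (s≤s z≤n) w<m)

  q*m-odd : ∀ q → q % 2 ≡ 1 → (q ℕ.* m) % 2 ≡ 1
  q*m-odd q q-odd = trans (%-distribˡ-* q m 2) (cong₂ (λ a b → (a ℕ.* b) % 2) q-odd m-odd)

  multiple-odd : ∀ n → n % m ≡ 0 → n < 4 ℕ.* m → n ≢ 0 → n ≢ 2 ℕ.* m → n % 2 ≡ 1
  multiple-odd n n%m≡0 n<4m n≢0 n≢2m
    with n / m | m<n*o⇒m/o<n {n} {4} n<4m | trans (m≡m%n+[m/n]*n n m) (cong (ℕ._+ (n / m) ℕ.* m) n%m≡0)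
  ... | 0 | _ | n≡ = ⊥-elim (n≢0 n≡)
  ... | 1 | _ | n≡ = trans (cong (_% 2) n≡) (q*m-odd 1 refl)
  ... | 2 | _ | n≡ = ⊥-elim (n≢2m n≡)
  ... | 3 | _ | n≡ = trans (cong (_% 2) n≡) (q*m-odd 3 refl)
  ... | suc (suc (suc (suc _))) | s≤s (s≤s (s≤s (s≤s ()))) | _

  oqs⇒reRot∈0± : IsOQS m f → ∀ n → n < 4 ℕ.* m → n ≢ 0 → n ≢ 2 ℕ.* m → reRot (n % 4) (Rf (n % m)) ∈0± 4
  oqs⇒reRot∈0± oqs n n<4m n≢0 n≢2m with n % m in n%m≡r | m%n<n n m
  ... | zero  | _   = inj₁ (trans (cong (reRot (n % 4)) Rf-0)
                              (reRot-odd-real n (+ m) (multiple-odd n n%m≡r n<4m n≢0 n≢2m)))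
  ... | suc w | w<m = reRot-∈0± (n % 4) (Rf (suc w)) (proj₁ parts) (proj₂ parts)
    where parts = IsUnit⇒parts (oqs⇒Rf-IsUnit oqs w w<m)

  oqs⇒zeros≡2 : IsOQS m f → ∀ (k : Fin m) → zeros (Rf (toℕ k)) ≡ 2
  oqs⇒zeros≡2 oqs k with toℕ k | toℕ<n k
  ... | zero  | _   = trans (cong zeros Rf-0) (zeros-positive m)
  ... | suc w | w<m = IsUnit⇒zeros≡2 (oqs⇒Rf-IsUnit oqs w w<m)

  opposite-parity : ∀ w → w % 2 ≡ 0 × (w ℕ.+ m) % 2 ≡ 1 ⊎ w % 2 ≡ 1 × (w ℕ.+ m) % 2 ≡ 0
  opposite-parity w with w % 2 | m%n<n w 2 | %-distribˡ-+ w m 2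
  ... | 0 | _ | eq = inj₁ (refl , trans eq (cong (λ r → (0 ℕ.+ r) % 2) m-odd))
  ... | 1 | _ | eq = inj₂ (refl , trans eq (cong (λ r → (1 ℕ.+ r) % 2) m-odd))
  ... | suc (suc _) | s≤s (s≤s ()) | _

  module Expansion (φ : Fin (2 ℕ.* m) → Bin) (rel : Related m f φ) where

    related-halves : ∀ (k : Fin m) →
        φat m φ (toℕ k ℕ.+ 0 ℕ.* m) ≡ ϕ₄ (toℕ k % 4) (toℂ (f k))
      × φat m φ (toℕ k ℕ.+ 1 ℕ.* m) ≡ ϕ₄ ((toℕ k % 4 ℕ.+ m % 4) % 4) (toℂ (f k))
    related-halves k with m % 4 | toℕ k % 4 | m%n<n (toℕ k) 4 | odd⇒%4≡1⊎3 m m-odd | rel 0F k | rel 1F k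
    ... | .1 | 0 | _ | inj₁ refl | ϕ₀ | ϕ₁ = sym ϕ₀ , sym ϕ₁
    ... | .1 | 1 | _ | inj₁ refl | ϕ₀ | ϕ₁ = x≡1*y⇒y≡x ϕ₁ , x≡-1*y⇒y≡-x ϕ₀
    ... | .1 | 2 | _ | inj₁ refl | ϕ₀ | ϕ₁ = x≡-y⇒y≡-x ϕ₀ , x≡-y⇒y≡-x ϕ₁
    ... | .1 | 3 | _ | inj₁ refl | ϕ₀ | ϕ₁ = x≡-1*y⇒y≡-x ϕ₁ , x≡1*y⇒y≡x ϕ₀
    ... | .3 | 0 | _ | inj₂ refl | ϕ₀ | ϕ₁ = x≡1*y⇒y≡x ϕ₀ , x≡-1*y⇒y≡-x ϕ₁
    ... | .3 | 1 | _ | inj₂ refl | ϕ₀ | ϕ₁ = sym ϕ₁ , sym ϕ₀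
    ... | .3 | 2 | _ | inj₂ refl | ϕ₀ | ϕ₁ = x≡-1*y⇒y≡-x ϕ₀ , x≡1*y⇒y≡x ϕ₁
    ... | .3 | 3 | _ | inj₂ refl | ϕ₀ | ϕ₁ = x≡-y⇒y≡-x ϕ₁ , x≡-y⇒y≡-x ϕ₀
    ... | _ | suc (suc (suc (suc _))) | s≤s (s≤s (s≤s (s≤s ()))) | _ | _ | _

    k+am≡j : ∀ j a → j ≡ j % m ℕ.+ a ℕ.* m → toℕ (j mod m) ℕ.+ a ℕ.* m ≡ j
    k+am≡j j a j≡ = trans (cong (ℕ._+ a ℕ.* m) (toℕ-fromℕ< _)) (sym j≡)

    φat≡ψ : ∀ j → j < 2 ℕ.* m → φat m φ j ≡ ψ j
    φat≡ψ j j<2m with j / m | m<n*o⇒m/o<n {j} {2} j<2m | m≡m%n+[m/n]*n j m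
    ... | 0 | _ | j≡ = begin
      φat m φ j                            ≡⟨ cong (φat m φ) (sym (k+am≡j j 0 j≡)) ⟩
      φat m φ (toℕ (j mod m) ℕ.+ 0 ℕ.* m)  ≡⟨ proj₁ (related-halves (j mod m)) ⟩
      ϕ₄ (toℕ (j mod m) % 4) (f̃ j)         ≡⟨ cong (λ i → ϕ₄ (i % 4) (f̃ j)) k≡j ⟩
      ψ j                                  ∎
      where
      k≡j : toℕ (j mod m) ≡ j
      k≡j = trans (sym (ℕP.+-identityʳ (toℕ (j mod m)))) (k+am≡j j 0 j≡)
    ... | 1 | _ | j≡ = begin
      φat m φ j                                     ≡⟨ cong (φat m φ) (sym (k+am≡j j 1 j≡)) ⟩
      φat m φ (toℕ (j mod m) ℕ.+ 1 ℕ.* m)           ≡⟨ proj₂ (related-halves (j mod m)) ⟩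
      ϕ₄ ((toℕ (j mod m) % 4 ℕ.+ m % 4) % 4) (f̃ j)  ≡⟨ cong (λ i → ϕ₄ i (f̃ j)) residue ⟩
      ψ j                                           ∎
      where
      residue : (toℕ (j mod m) % 4 ℕ.+ m % 4) % 4 ≡ j % 4
      residue = trans (sym (%-distribˡ-+ (toℕ (j mod m)) m 4)) (cong (_% 4)
                  (trans (cong (toℕ (j mod m) ℕ.+_) (sym (ℕP.*-identityˡ m))) (k+am≡j j 1 j≡)))
    ... | suc (suc _) | s≤s (s≤s ()) | _

    expansion≡ψ : ∀ b → expansion m φ b ≡ ψ (toℕ b)
    expansion≡ψ b with toℕ b <? 2 ℕ.* m
    ... | yes b<2m = φat≡ψ (toℕ b) b<2m
    ... | no  b≮2m = begin
      - φat m φ (toℕ b ℕ.∸ 2 ℕ.* m)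
        ≡⟨ cong -_ (φat≡ψ (toℕ b ℕ.∸ 2 ℕ.* m) (ℕP.m<n+o⇒m∸n<o (toℕ b) (2 ℕ.* m) b<2m+2m)) ⟩
      - ψ (toℕ b ℕ.∸ 2 ℕ.* m)                 ≡⟨ ψ-antiperiodic (toℕ b ℕ.∸ 2 ℕ.* m) ⟨
      ψ (toℕ b ℕ.∸ 2 ℕ.* m ℕ.+ 2 ℕ.* m)       ≡⟨ cong ψ (ℕP.m∸n+n≡m (ℕP.≮⇒≥ b≮2m)) ⟩
      ψ (toℕ b)                               ∎
      where
      b<2m+2m : toℕ b < 2 ℕ.* m ℕ.+ 2 ℕ.* m
      b<2m+2m = subst (toℕ b <_) (ℕP.*-distribʳ-+ m 2 2) (toℕ<n b)

    R′ : ℕ → ℤ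
    R′ = R (4 ℕ.* m) (expansion m φ)

    R′≡reRot : ∀ x → R′ x ≡ reRot (x % 4) (Rf x)
    R′≡reRot x = begin
      R′ x
        ≡⟨ ∑≡sum (4 ℕ.* m) _ ⟩
      ℤSum.sum (λ (b : Fin (4 ℕ.* m)) → expansion m φ b * expansion m φ (shift (4 ℕ.* m) b x))
        ≡⟨ ℤSum.sum-cong-≗ {4 ℕ.* m} (λ b → cong₂ _*_ (expansion≡ψ b) (shifted b)) ⟩
      ℤSum.sum (λ (b : Fin (4 ℕ.* m)) → ψ (toℕ b) * ψ (toℕ b ℕ.+ x))
        ≡⟨ ψ-autocorrelation x ⟩
      reRot (x % 4) (Rf x) ∎
      where
      shifted : ∀ b → expansion m φ (shift (4 ℕ.* m) b x) ≡ ψ (toℕ b ℕ.+ x)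
      shifted b = trans (expansion≡ψ (shift (4 ℕ.* m) b x))
        (trans (cong ψ (toℕ-fromℕ< (m%n<n (toℕ b ℕ.+ x) (4 ℕ.* m)))) (ψ-mod (toℕ b ℕ.+ x)))

    R′-residues : ∀ n → R′ n ≡ reRot (n % 4) (Rf (n % m))
    R′-residues n = trans (R′≡reRot n) (cong (reRot (n % 4)) (Rf-residue n))

    oqs⇒gobs : IsOQS m f → IsGOBS m φ
    oqs⇒gobs oqs = values , zero-count
      where
      values : ∀ (x : Fin (4 ℕ.* m)) → toℕ x ≢ 0 → toℕ x ≢ 2 ℕ.* m → R′ (toℕ x) ∈0± 4
      values x x≢0 x≢2m = subst (_∈0± 4) (sym (R′-residues (toℕ x)))
                            (oqs⇒reRot∈0± oqs (toℕ x) (toℕ<n x) x≢0 x≢2m)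
      zero-count : count (4 ℕ.* m) (λ x → ⌊ R′ (toℕ x) ℤ.≟ + 0 ⌋) ≡ 2 ℕ.* m
      zero-count = begin
        count (4 ℕ.* m) (λ x → ⌊ R′ (toℕ x) ℤ.≟ + 0 ⌋)
          ≡⟨ count≡sum (4 ℕ.* m) (R′ ∘ toℕ) ⟩
        ℕSum.sum (λ (n : Fin (4 ℕ.* m)) → isZero (R′ (toℕ n)))
          ≡⟨ ℕSum.sum-cong-≗ {4 ℕ.* m} (λ n → cong isZero (R′-residues (toℕ n))) ⟩
        ℕSum.sum (λ (n : Fin (4 ℕ.* m)) → isZero (reRot (toℕ n % 4) (Rf (toℕ n % m))))
          ≡⟨ ℕSum.∑-residues m m-odd (λ c k → isZero (reRot c (Rf k))) ⟩
        ℕSum.sum (λ (k : Fin m) → zeros (Rf (toℕ k)))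
          ≡⟨ ℕSum.sum-cong-≗ {m} (oqs⇒zeros≡2 oqs) ⟩
        ℕSum.sum {m} (λ _ → 2)
          ≡⟨ sum-const m 2 ⟩
        m ℕ.* 2
          ≡⟨ ℕP.*-comm m 2 ⟩
        2 ℕ.* m ∎

    gobs⇒reRot∈0± : IsGOBS m φ → ∀ n → n < 4 ℕ.* m → n % m ≢ 0 → reRot (n % 4) (Rf n) ∈0± 4
    gobs⇒reRot∈0± gobs n n<4m n%m≢0 =
      subst (_∈0± 4) (trans (cong R′ (toℕ-fromℕ< n<4m)) (R′≡reRot n))
        (proj₁ gobs (fromℕ< n<4m) (≢-multiple 0) (≢-multiple 2))
      where
      ≢-multiple : ∀ q → toℕ (fromℕ< n<4m) ≢ q ℕ.* m
      ≢-multiple q eq = n%m≢0 (trans (cong (_% m) (trans (sym (toℕ-fromℕ< n<4m)) eq)) (m*n%n≡0 q m))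

    gobs⇒oqs : IsGOBS m φ → IsOQS m f
    gobs⇒oqs gobs w 1≤w w<m = IsUnit⇒normSq≡1 (parts⇒IsUnit (Rf w) (proj₁ parts) (proj₂ parts) (Rf-Odd w))
      where
      w%m≢0 : w % m ≢ 0
      w%m≢0 eq = ℕP.<⇒≢ 1≤w (sym (trans (sym (m<n⇒m%n≡m w<m)) eq))
      at-w : reRot (w % 4) (Rf w) ∈0± 4
      at-w = gobs⇒reRot∈0± gobs w (ℕP.<-≤-trans w<m (ℕP.m≤m+n m (3 ℕ.* m))) w%m≢0
      at-w+m : reRot ((w ℕ.+ m) % 4) (Rf w) ∈0± 4
      at-w+m = subst (λ z → reRot ((w ℕ.+ m) % 4) z ∈0± 4) (Rf-cong ([m+n]%n≡m%n w m))
        (gobs⇒reRot∈0± gobs (w ℕ.+ m)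
          (ℕP.<-≤-trans (ℕP.+-monoˡ-< m w<m) (ℕP.+-monoʳ-≤ m (ℕP.m≤m+n m (2 ℕ.* m))))
          (w%m≢0 ∘ trans (sym ([m+n]%n≡m%n w m))))
      parts : re (Rf w) ∈0± 1 × im (Rf w) ∈0± 1
      parts with opposite-parity w
      ... | inj₁ (w-even , w+m-odd) =
        reRot-even⇒re∈0± w (Rf w) w-even at-w , reRot-odd⇒im∈0± (w ℕ.+ m) (Rf w) w+m-odd at-w+m
      ... | inj₂ (w-odd , w+m-even) =
        reRot-even⇒re∈0± (w ℕ.+ m) (Rf w) w+m-even at-w+m , reRot-odd⇒im∈0± w (Rf w) w-odd at-w

corollary1 : (m : ℕ) .{{_ : NonZero m}} → 1 < m → m % 2 ≡ 1 →
    (f : Fin m → Quat) (φ : Fin (2 Data.Nat.* m) → Bin) → Related m f φ →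
    (IsOQS m f → IsGOBS m φ) × (IsGOBS m φ → IsOQS m f)
corollary1 m _ m-odd f φ rel = oqs⇒gobs , gobs⇒oqs
  where open Correspondence.Expansion m m-odd f φ rel
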